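{- Let $r,t$ be positive integers with $r\ge t$, and let $k$ be an integer. (i) If $1<k<t$, then $\operatorname{msad}_k(K_{r,t})=t-k$. (ii) If $k=t$, then $\operatorname{msad}_k(K_{r,t})=1$ if $r>t$, and $\operatorname{msad}_k(K_{r,t})=r$ if $r=t$. (iii) If $t<k\le r$, then $\operatorname{msad}_k(K_{r,t})=r+t-k$. (iv) If $r<k\le r+t-2$ and either ($k$ is even and $r+t$ is even) or ($k$ is odd and $r+t$ is odd), then $\operatorname{msad}_k(K_{r,t})=r+t-k$. (v) If $r<k\le r+t-2$ and either ($k$ is even and $r+t$ is odd) or ($k$ is odd and $r+t$ is even), then $K_{r,t}$ does not contain any $k$-MARS.
   Context: $K_{r,t}$ is the complete bipartite graph with parts of sizes $r$ and $t$. For a connected graph $G$, $S\subseteq V(G)$ and $x\in V(G)$, $m(x|S)$ is the multiset $\{\!\{d_G(x,s): s\in S\}\!\}$ of shortest-path distances. A nonempty set $S\subsetneq V(G)$ is a $k$-multiset antiresolving set ($k$-MARS) if $k$ equals the minimum size of an equivalence class of the relation on $V(G)\setminus S$ given by $x\sim y \iff m(x|S)=m(y|S)$. $\operatorname{msad}_k(G)$ is the minimum cardinality of a $k$-MARS of $G$ (and $\infty$ if none exists). -}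

module Defs where

open import Data.Nat using (ℕ; zero; suc; _+_; _≤_; _<ᵇ_)
open import Data.Nat.Divisibility using (_∣_)
open import Data.Bool using (Bool; true; false; if_then_else_; _∨_; _∧_; _xor_)
open import Data.Fin using (Fin; toℕ)
open import Data.Fin.Subset using (Subset; _∈_; _∉_; ∣_∣; Nonempty)
open import Data.List using (List; []; _∷_; map; length; allFin; filter)
open import Data.Bool.ListAction using (any)
open import Data.Fin.Subset.Properties using (_∈?_)
open import Data.List.Relation.Unary.Unique.Propositional using (Unique)
import Data.List.Membership.Propositional as LM
open import Data.List.Relation.Binary.Permutation.Propositional using (_↭_)
open import Data.Product using (Σ; ∃; _×_; _,_)
open import Relation.Binary.PropositionalEquality using (_≡_)
open import Relation.Nullary using (¬_)
open import Function.Bundles using (_⇔_)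

Graph : ℕ → Set
Graph n = Fin n → Fin n → Bool

_==_ : ∀ {n} → Fin n → Fin n → Bool
x == y = Data.Nat._≡ᵇ_ (toℕ x) (toℕ y)

within : ∀ {n} → Graph n → ℕ → Fin n → Fin n → Bool
within G zero    x y = x == y
within G (suc k) x y = within G k x y ∨ any (λ z → G x z ∧ within G k z y) (allFin _)

-- Shortest-path distance: least k (searched from 0, at most n steps) with a walk of length ≤ k.
-- For connected graphs on n vertices every distance is < n, so this is d_G(x,y).
dist : ∀ {n} → Graph n → Fin n → Fin n → ℕ
dist {n} G x y = search 0 n
  where
  search : ℕ → ℕ → ℕ
  search k zero    = k
  search k (suc f) = if within G k x y then k else search (suc k) f

-- The complete bipartite graph K_{r,t}: vertices Fin (r + t); vertex i lies in the
-- first part (size r) iff toℕ i < r; adjacent iff in different parts.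
K : (r t : ℕ) → Graph (r + t)
K r t x y = (toℕ x <ᵇ r) xor (toℕ y <ᵇ r)

elems : ∀ {n} → Subset n → List (Fin n)
elems S = filter (λ s → s ∈? S) (allFin _)

-- m(x|S) : multiset of distances, represented as a list up to permutation.
m : ∀ {n} → Graph n → Fin n → Subset n → List ℕ
m G x S = map (dist G x) (elems S)

_∼[_,_]_ : ∀ {n} → Fin n → Graph n → Subset n → Fin n → Set
x ∼[ G , S ] y = m G x S ↭ m G y S

ClassSize : ∀ {n} → Graph n → Subset n → Fin n → ℕ → Set
ClassSize G S x c =
  Σ (List _) λ L → Unique L × length L ≡ c ×
    (∀ y → (y LM.∈ L) ⇔ ((y ∉ S) × (y ∼[ G , S ] x)))

IsMARS : ∀ {n} → Graph n → ℕ → Subset n → Set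
IsMARS G k S =
  Nonempty S × (∃ λ x → x ∉ S) ×
  (∃ λ x → x ∉ S × ClassSize G S x k) ×
  (∀ x c → x ∉ S → ClassSize G S x c → k ≤ c)

MsadIs : ∀ {n} → Graph n → ℕ → ℕ → Set
MsadIs G k v =
  (∃ λ S → IsMARS G k S × ∣ S ∣ ≡ v) × (∀ S → IsMARS G k S → v ≤ ∣ S ∣)

NoMARS : ∀ {n} → Graph n → ℕ → Set
NoMARS G k = ∀ S → ¬ IsMARS G k S

Even : ℕ → Set
Even n = 2 ∣ n

Odd : ℕ → Set
Odd n = ¬ Even n

-- Write X and Y for the parts of K r t (of sizes r and t) and a = |S ∩ X|, b = |S ∩ Y|.
-- A vertex outside S is at distance 1 from the vertices of S in the other part and at
-- distance 2 from those in its own part, so its distance multiset is {1^b, 2^a} on X and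
-- {1^a, 2^b} on Y. Comparing sums, these agree only when a = b. Hence the classes of V ∖ S
-- are X ∖ S and Y ∖ S when a ≠ b, and V ∖ S itself when a = b: S is a k-MARS iff k is the
-- least nonzero number among r − a and t − b (a ≠ b), or k = r + t − 2a (a = b). Each part
-- of the theorem is then a minimisation of a + b over such pairs (a, b); the parity
-- conditions come from the balanced case k + 2a = r + t.

module Submission where

open import Defs
open import Data.Nat using (ℕ; _+_; _∸_; _≤_; _<_; _≥_; _>_)
open import Data.Product using (_×_)
open import Data.Sum using (_⊎_)
open import Relation.Binary.PropositionalEquality using (_≡_)

open import Data.Bool using (Bool; true; false; T; not; _∧_; _∨_; _xor_; if_then_else_)
open import Data.Bool.ListAction using (any)
open import Data.Bool.Properties using (T-∧; T-∨; ¬-not; not-¬)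
open import Data.Empty using (⊥-elim)
open import Data.Fin using (Fin; zero; suc; toℕ)
open import Data.Fin.Properties using (toℕ-injective)
open import Data.Fin.Subset using (Subset; inside; outside; _∈_; _∉_; ∣_∣; ∁; _∩_; Nonempty)
open import Data.Fin.Subset.Properties
  using (_∈?_; ∣p∣≤∣x∷p∣; ∣∁p∣≡n∸∣p∣; x∈∁p⇒x∉p; x∉p⇒x∈∁p; x∈p∩q⁺; x∈p∩q⁻; ∩-comm)
open import Data.List as List using (List; []; _∷_; map; length; allFin; filter; _++_; replicate)
open import Data.List.Properties using (map-tabulate; length-map; length-++; map-++)
open import Data.List.Membership.Propositional using (lose) renaming (_∈_ to _∈ˡ_)
open import Data.List.Membership.Propositional.Properties using (∈-filter⁺; ∈-filter⁻; ∈-allFin)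
open import Data.List.Membership.Propositional.Properties.WithK using (unique∧set⇒bag)
open import Data.List.Relation.Binary.BagAndSetEquality using (∼bag⇒↭)
open import Data.List.Relation.Binary.Permutation.Propositional
  using (_↭_; ↭-refl; ↭-sym; ↭-trans; ↭-reflexive; module PermutationReasoning)
open import Data.List.Relation.Binary.Permutation.Propositional.Properties
  using (map⁺; shift; ++-comm; ↭-length)
open import Data.List.Relation.Unary.Any as Any using (satisfied)
open import Data.List.Relation.Unary.Any.Properties using (any⁺; any⁻)
open import Data.List.Relation.Unary.Unique.Propositional using (Unique)
import Data.List.Relation.Unary.Unique.Propositional.Properties as Unique
open import Data.Nat using (zero; suc; _*_; z≤n; s≤s; _<ᵇ_; _≟_)
open import Data.Nat.Divisibility using (divides; ∣m∣n⇒∣m+n; ∣m+n∣m⇒∣n; ∣-refl)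
open import Data.Nat.ListAction using (sum)
open import Data.Nat.ListAction.Properties using (sum-++; sum-↭)
open import Data.Nat.Properties
  using (≤-trans; ≤-refl; ≤-reflexive; <⇒≤; <⇒≢; <⇒≱; ≮⇒≥; ≤-<-trans; n≤0⇒n≡0; module ≤-Reasoning;
         ≡ᵇ⇒≡; ≡⇒≡ᵇ; +-comm; +-identityʳ; +-cancelˡ-≡; +-cancelʳ-≡; +-cancelˡ-≤; +-cancelʳ-≤;
         +-cancelˡ-<; +-mono-≤; +-monoʳ-≤; +-monoˡ-<; m≤m+n; m≤n+m; m+n∸m≡n; m∸n+n≡m; m+[n∸m]≡n;
         m∸n≤m; m<n⇒0<n∸m; m≤n+o⇒m∸n≤o; m≤o∸n⇒m+n≤o; ∸-monoˡ-≤; +-∸-comm)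
open import Data.Nat.Tactic.RingSolver using (solve-∀)
open import Data.Product using (Σ; ∃; _,_; proj₁; proj₂)
open import Data.Sum using (inj₁; inj₂)
open import Data.Vec using (_∷_; []; here; there; tabulate)
open import Data.Vec.Properties using (lookup∘tabulate; []=⇒lookup; lookup⇒[]=)
open import Function.Base using (_∘_)
open import Function.Bundles using (_⇔_; mk⇔; Equivalence)
open import Function.Properties.Equivalence using () renaming (trans to ⇔-trans; sym to ⇔-sym)
open import Relation.Nullary using (¬_; does; yes; no)
open import Relation.Binary.PropositionalEquality
  using (_≢_; ≢-sym; refl; cong; cong₂; sym; trans; subst; module ≡-Reasoning)

private
  variable
    n r t k : ℕ

-- Enumerating subsets

private
  filter-∈?-map-suc : ∀ s (p : Subset n) (xs : List (Fin n)) →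
                      filter (_∈? (s ∷ p)) (map suc xs) ≡ map suc (filter (_∈? p) xs)
  filter-∈?-map-suc s p []       = refl
  filter-∈?-map-suc s p (x ∷ xs) with does (x ∈? p)
  ... | true  = cong (suc x ∷_) (filter-∈?-map-suc s p xs)
  ... | false = filter-∈?-map-suc s p xs

  elems-tail : ∀ s (p : Subset n) → filter (_∈? (s ∷ p)) (List.tabulate suc) ≡ map suc (elems p)
  elems-tail {n} s p = trans (cong (filter _) (sym (map-tabulate (λ i → i) suc)))
                             (filter-∈?-map-suc s p (allFin n))

elems-inside : (p : Subset n) → elems (inside ∷ p) ≡ zero ∷ map suc (elems p)
elems-inside p = cong (zero ∷_) (elems-tail inside p)

elems-outside : (p : Subset n) → elems (outside ∷ p) ≡ map suc (elems p)
elems-outside p = elems-tail outside p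

∈-elems⇔∈ : ∀ {p : Subset n} {x} → x ∈ˡ elems p ⇔ x ∈ p
∈-elems⇔∈ {p = p} {x} = mk⇔ (λ x∈ → proj₂ (∈-filter⁻ (_∈? p) {xs = allFin _} x∈))
                            (∈-filter⁺ (_∈? p) (∈-allFin x))

elems-unique : (p : Subset n) → Unique (elems p)
elems-unique {n} p = Unique.filter⁺ (_∈? p) (Unique.allFin⁺ n)

length-elems : (p : Subset n) → length (elems p) ≡ ∣ p ∣
length-elems []            = refl
length-elems (inside ∷ p)  = begin
  length (elems (inside ∷ p))       ≡⟨ cong length (elems-inside p) ⟩
  suc (length (map suc (elems p)))  ≡⟨ cong suc (length-map suc (elems p)) ⟩
  suc (length (elems p))            ≡⟨ cong suc (length-elems p) ⟩
  suc ∣ p ∣                         ∎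
  where open ≡-Reasoning
length-elems (outside ∷ p) = begin
  length (elems (outside ∷ p))      ≡⟨ cong length (elems-outside p) ⟩
  length (map suc (elems p))        ≡⟨ length-map suc (elems p) ⟩
  length (elems p)                  ≡⟨ length-elems p ⟩
  ∣ p ∣                             ∎
  where open ≡-Reasoning

elems-∩-∁-↭ : (q p : Subset n) → elems p ↭ elems (q ∩ p) ++ elems (∁ q ∩ p)
map-suc-elems-∩-∁-↭ : (q p : Subset n) →
                      map suc (elems p) ↭ map suc (elems (q ∩ p)) ++ map suc (elems (∁ q ∩ p))

elems-∩-∁-↭ []            []            = ↭-refl
elems-∩-∁-↭ (inside ∷ q)  (inside ∷ p)  = begin
  elems (inside ∷ p)                                           ≡⟨ elems-inside p ⟩
  zero ∷ map suc (elems p)                                     <⟨ map-suc-elems-∩-∁-↭ q p ⟩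
  zero ∷ map suc (elems (q ∩ p)) ++ map suc (elems (∁ q ∩ p))
    ≡⟨ cong₂ _++_ (elems-inside (q ∩ p)) (elems-outside (∁ q ∩ p)) ⟨
  elems (inside ∷ q ∩ p) ++ elems (outside ∷ ∁ q ∩ p)          ∎
  where open PermutationReasoning
elems-∩-∁-↭ (outside ∷ q) (inside ∷ p)  = begin
  elems (inside ∷ p)                                           ≡⟨ elems-inside p ⟩
  zero ∷ map suc (elems p)                                     <⟨ map-suc-elems-∩-∁-↭ q p ⟩
  zero ∷ map suc (elems (q ∩ p)) ++ map suc (elems (∁ q ∩ p))
    ↭⟨ shift zero (map suc (elems (q ∩ p))) (map suc (elems (∁ q ∩ p))) ⟨
  map suc (elems (q ∩ p)) ++ zero ∷ map suc (elems (∁ q ∩ p))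
    ≡⟨ cong₂ _++_ (elems-outside (q ∩ p)) (elems-inside (∁ q ∩ p)) ⟨
  elems (outside ∷ q ∩ p) ++ elems (inside ∷ ∁ q ∩ p)          ∎
  where open PermutationReasoning
elems-∩-∁-↭ (inside ∷ q)  (outside ∷ p) = begin
  elems (outside ∷ p)                                          ≡⟨ elems-outside p ⟩
  map suc (elems p)                                            ↭⟨ map-suc-elems-∩-∁-↭ q p ⟩
  map suc (elems (q ∩ p)) ++ map suc (elems (∁ q ∩ p))
    ≡⟨ cong₂ _++_ (elems-outside (q ∩ p)) (elems-outside (∁ q ∩ p)) ⟨
  elems (outside ∷ q ∩ p) ++ elems (outside ∷ ∁ q ∩ p)         ∎
  where open PermutationReasoning
elems-∩-∁-↭ (outside ∷ q) (outside ∷ p) = begin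
  elems (outside ∷ p)                                          ≡⟨ elems-outside p ⟩
  map suc (elems p)                                            ↭⟨ map-suc-elems-∩-∁-↭ q p ⟩
  map suc (elems (q ∩ p)) ++ map suc (elems (∁ q ∩ p))
    ≡⟨ cong₂ _++_ (elems-outside (q ∩ p)) (elems-outside (∁ q ∩ p)) ⟨
  elems (outside ∷ q ∩ p) ++ elems (outside ∷ ∁ q ∩ p)         ∎
  where open PermutationReasoning

map-suc-elems-∩-∁-↭ q p = ↭-trans (map⁺ suc (elems-∩-∁-↭ q p))
                                  (↭-reflexive (map-++ suc (elems (q ∩ p)) (elems (∁ q ∩ p))))

∣q∩p∣+∣∁q∩p∣≡∣p∣ : (q p : Subset n) → ∣ q ∩ p ∣ + ∣ ∁ q ∩ p ∣ ≡ ∣ p ∣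
∣q∩p∣+∣∁q∩p∣≡∣p∣ q p = begin
  ∣ q ∩ p ∣ + ∣ ∁ q ∩ p ∣                             ≡⟨ cong₂ _+_ (length-elems (q ∩ p))
                                                                    (length-elems (∁ q ∩ p)) ⟨
  length (elems (q ∩ p)) + length (elems (∁ q ∩ p))   ≡⟨ length-++ (elems (q ∩ p)) ⟨
  length (elems (q ∩ p) ++ elems (∁ q ∩ p))           ≡⟨ ↭-length (elems-∩-∁-↭ q p) ⟨
  length (elems p)                                    ≡⟨ length-elems p ⟩
  ∣ p ∣                                               ∎
  where open ≡-Reasoning

map-elems-const : ∀ {A : Set} {f : Fin n → A} {u : A} (p : Subset n) →
                  (∀ {s} → s ∈ p → f s ≡ u) → map f (elems p) ≡ replicate ∣ p ∣ u
map-elems-const {f = f} {u} p f≡u =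
  trans (map-const-on (elems p) (f≡u ∘ Equivalence.to ∈-elems⇔∈))
        (cong (λ k → replicate k u) (length-elems p))
  where
  map-const-on : ∀ xs → (∀ {s} → s ∈ˡ xs → f s ≡ u) → map f xs ≡ replicate (length xs) u
  map-const-on []       _   = refl
  map-const-on (x ∷ xs) f≡u = cong₂ _∷_ (f≡u (Any.here refl)) (map-const-on xs (f≡u ∘ Any.there))

x∈p⇒0<∣p∣ : ∀ {p : Subset n} {x} → x ∈ p → 0 < ∣ p ∣
x∈p⇒0<∣p∣ here                    = s≤s z≤n
x∈p⇒0<∣p∣ {p = s ∷ p} (there x∈p) = ≤-trans (x∈p⇒0<∣p∣ x∈p) (∣p∣≤∣x∷p∣ s p)

0<∣p∣⇒nonempty : ∀ {p : Subset n} → 0 < ∣ p ∣ → Nonempty p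
0<∣p∣⇒nonempty {p = inside  ∷ p} _     = zero , here
0<∣p∣⇒nonempty {p = outside ∷ p} 0<∣p∣ with x , x∈p ← 0<∣p∣⇒nonempty 0<∣p∣ = suc x , there x∈p

∩-∁-sizes : (p : Subset n) {a b : ℕ} → a ≤ ∣ p ∣ → b ≤ ∣ ∁ p ∣ →
            ∃ λ q → ∣ p ∩ q ∣ ≡ a × ∣ ∁ p ∩ q ∣ ≡ b
∩-∁-sizes []            z≤n z≤n = [] , refl , refl
∩-∁-sizes (inside ∷ p)  {zero}  _           b≤∣∁p∣
  with q , eqa , eqb ← ∩-∁-sizes p z≤n b≤∣∁p∣       = outside ∷ q , eqa , eqb
∩-∁-sizes (inside ∷ p)  {suc a} (s≤s a≤∣p∣) b≤∣∁p∣
  with q , eqa , eqb ← ∩-∁-sizes p a≤∣p∣ b≤∣∁p∣     = inside ∷ q , cong suc eqa , eqb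
∩-∁-sizes (outside ∷ p) {b = zero}  a≤∣p∣ _
  with q , eqa , eqb ← ∩-∁-sizes p a≤∣p∣ z≤n        = outside ∷ q , eqa , eqb
∩-∁-sizes (outside ∷ p) {b = suc b} a≤∣p∣ (s≤s b≤∣∁p∣)
  with q , eqa , eqb ← ∩-∁-sizes p a≤∣p∣ b≤∣∁p∣     = inside ∷ q , eqa , cong suc eqb

∈-tabulate⇔ : ∀ {f : Fin n → Bool} {x} → x ∈ tabulate f ⇔ f x ≡ true
∈-tabulate⇔ {f = f} {x} = mk⇔ (λ x∈ → trans (sym (lookup∘tabulate f x)) ([]=⇒lookup x∈))
                              (λ fx → lookup⇒[]= x _ (trans (lookup∘tabulate f x) fx))

∣tabulate-<ᵇ∣ : ∀ {n} m → m ≤ n → ∣ tabulate {n = n} (λ i → toℕ i <ᵇ m) ∣ ≡ m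
∣tabulate-<ᵇ∣ {zero}  zero    z≤n       = refl
∣tabulate-<ᵇ∣ {suc n} zero    z≤n       = ∣tabulate-<ᵇ∣ {n} zero z≤n
∣tabulate-<ᵇ∣ {suc n} (suc m) (s≤s m≤n) = cong suc (∣tabulate-<ᵇ∣ m m≤n)

-- Graphs of diameter two

private
  ==⇒≡ : ∀ {x y : Fin n} → T (x == y) → x ≡ y
  ==⇒≡ {x = x} {y} eq = toℕ-injective (≡ᵇ⇒≡ (toℕ x) (toℕ y) eq)

  ==-refl : (x : Fin n) → T (x == x)
  ==-refl x = ≡⇒≡ᵇ (toℕ x) (toℕ x) refl

  ≢⇒==-false : ∀ {x y : Fin n} → x ≢ y → (x == y) ≡ false
  ≢⇒==-false {x = x} {y} x≢y with x == y in eq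
  ... | true  = ⊥-elim (x≢y (==⇒≡ (subst T (sym eq) _)))
  ... | false = refl

module _ {n : ℕ} (G : Graph n) where

  private
    adjacent⇒any : ∀ {x y} → T (G x y) → T (any (λ z → G x z ∧ (z == y)) (allFin n))
    adjacent⇒any {y = y} Gxy = any⁺ _ (lose (∈-allFin y) (Equivalence.from T-∧ (Gxy , ==-refl y)))

  within-1 : ∀ {x y} → x ≢ y → within G 1 x y ≡ G x y
  within-1 {x} {y} x≢y rewrite ≢⇒==-false x≢y
    with G x y in Gxy | any (λ z → G x z ∧ (z == y)) (allFin n) in some-z
  ... | true  | true  = refl
  ... | false | false = refl
  ... | true  | false = ⊥-elim (subst T some-z (adjacent⇒any (subst T (sym Gxy) _)))
  ... | false | true
    with z , Gxz∧z==y ← satisfied (any⁻ _ (allFin n) (subst T (sym some-z) _))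
    with Gxz , z==y ← Equivalence.to T-∧ Gxz∧z==y
    = ⊥-elim (subst T Gxy (subst (T ∘ G x) (==⇒≡ z==y) Gxz))

  within-2 : ∀ {x y z} → T (G x z) → T (G z y) → T (within G 2 x y)
  within-2 {z = z} Gxz Gzy =
    Equivalence.from T-∨ (inj₂ (any⁺ _ (lose (∈-allFin z)
      (Equivalence.from T-∧ (Gxz , Equivalence.from T-∨ (inj₂ (adjacent⇒any Gzy)))))))

private
  search-stops-at-1-or-2 : ∀ {b₀ b₁ c : Bool} {later : ℕ} → b₀ ≡ false → b₁ ≡ c → (c ≡ false → later ≡ 2) →
                           (if b₀ then 0 else if b₁ then 1 else later) ≡ (if c then 1 else 2)
  search-stops-at-1-or-2 {c = true}  refl refl _     = refl
  search-stops-at-1-or-2 {c = false} refl refl later = later refl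

  if-T : ∀ {b : Bool} {x y : ℕ} → T b → (if b then x else y) ≡ x
  if-T {true} _ = refl

dist-diameter₂ : ∀ (G : Graph n) {x y} → x ≢ y → (G x y ≡ false → ∃ λ z → T (G x z) × T (G z y)) →
                 dist G x y ≡ (if G x y then 1 else 2)
dist-diameter₂ {zero}              G {()}
dist-diameter₂ {suc zero}          G {zero} {zero} x≢y _ = ⊥-elim (x≢y refl)
-- With two vertices the search in dist runs out of fuel at distance 2 and returns 2 unchecked.
dist-diameter₂ {suc (suc zero)}    G x≢y _ =
  search-stops-at-1-or-2 (≢⇒==-false x≢y) (within-1 G x≢y) (λ _ → refl)
dist-diameter₂ {suc (suc (suc _))} G x≢y common =
  search-stops-at-1-or-2 (≢⇒==-false x≢y) (within-1 G x≢y) λ Gxy≡false →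
    let z , Gxz , Gzy = common Gxy≡false in if-T (within-2 G Gxz Gzy)

-- Equivalence classes

IsClass : Graph n → Subset n → Fin n → Subset n → Set
IsClass G S x P = ∀ y → y ∈ P ⇔ (y ∉ S × y ∼[ G , S ] x)

module _ {G : Graph n} {S : Subset n} {x : Fin n} {P : Subset n} (P-class : IsClass G S x P) where

  IsClass⇒ClassSize : ClassSize G S x ∣ P ∣
  IsClass⇒ClassSize = elems P , elems-unique P , length-elems P , λ y → ⇔-trans ∈-elems⇔∈ (P-class y)

  ClassSize⇒≡∣P∣ : ∀ {c} → ClassSize G S x c → c ≡ ∣ P ∣
  ClassSize⇒≡∣P∣ {c} (L , L-unique , ∣L∣≡c , L-class) = begin
    c                 ≡⟨ ∣L∣≡c ⟨
    length L          ≡⟨ ↭-length (∼bag⇒↭ (unique∧set⇒bag L-unique (elems-unique P) L≐P)) ⟩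
    length (elems P)  ≡⟨ length-elems P ⟩
    ∣ P ∣             ∎
    where
    open ≡-Reasoning
    L≐P = λ {y} → ⇔-trans (L-class y) (⇔-sym (⇔-trans ∈-elems⇔∈ (P-class y)))

-- Complete bipartite graphs

sideDist : Bool → Bool → ℕ
sideDist c c′ = if c xor c′ then 1 else 2

profile : ℕ → ℕ → Bool → List ℕ
profile a b c = replicate a (sideDist c true) ++ replicate b (sideDist c false)

private
  sum-replicate : ∀ k m → sum (replicate k m) ≡ k * m
  sum-replicate zero    m = refl
  sum-replicate (suc k) m = cong (m +_) (sum-replicate k m)

sum-profile : ∀ a b c → sum (profile a b c) ≡ (a + b) + (if c then a else b)
sum-profile a b c = begin
  sum (profile a b c)                          ≡⟨ sum-++ (replicate a _) (replicate b _) ⟩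
  sum (replicate a _) + sum (replicate b _)    ≡⟨ cong₂ _+_ (sum-replicate a _) (sum-replicate b _) ⟩
  a * sideDist c true + b * sideDist c false   ≡⟨ regroup c ⟩
  (a + b) + (if c then a else b)               ∎
  where
  open ≡-Reasoning
  regroup : ∀ c → a * sideDist c true + b * sideDist c false ≡ (a + b) + (if c then a else b)
  regroup true  = 2a+b a b
    where 2a+b : ∀ a b → a * 2 + b * 1 ≡ (a + b) + a
          2a+b = solve-∀
  regroup false = a+2b a b
    where a+2b : ∀ a b → a * 1 + b * 2 ≡ (a + b) + b
          a+2b = solve-∀

profile-balanced : ∀ a c c′ → profile a a c ↭ profile a a c′
profile-balanced a true  true  = ↭-refl
profile-balanced a false false = ↭-refl
profile-balanced a true  false = ++-comm (replicate a 2) (replicate a 1)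
profile-balanced a false true  = ++-comm (replicate a 1) (replicate a 2)

profile-↭⇔ : ∀ {a b c c′} → (profile a b c ↭ profile a b c′) ⇔ (c ≡ c′ ⊎ a ≡ b)
profile-↭⇔ {a} {b} {c} {c′} = mk⇔ (to c c′) from
  where
  opposite-sides : ∀ {c c′} → profile a b c ↭ profile a b c′ → (if c then a else b) ≡ (if c′ then a else b)
  opposite-sides p = +-cancelˡ-≡ (a + b) _ _
    (trans (sym (sum-profile a b _)) (trans (sum-↭ p) (sum-profile a b _)))
  to : ∀ c c′ → profile a b c ↭ profile a b c′ → c ≡ c′ ⊎ a ≡ b
  to true  true  _ = inj₁ refl
  to false false _ = inj₁ refl
  to true  false p = inj₂ (opposite-sides p)
  to false true  p = inj₂ (sym (opposite-sides p))
  from : c ≡ c′ ⊎ a ≡ b → profile a b c ↭ profile a b c′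
  from (inj₁ refl) = ↭-refl
  from (inj₂ a≡b)  = subst (λ b → profile a b c ↭ profile a b c′) a≡b (profile-balanced a c c′)

LeastNonzero : ℕ → ℕ → ℕ → Set
LeastNonzero k m n = ((k ≡ m ⊎ k ≡ n) × 0 < k) × (0 < m → k ≤ m) × (0 < n → k ≤ n)

data MinClassSize (k a b oa ob : ℕ) : Set where
  balanced   : a ≡ b → 0 < k → k ≡ oa + ob → MinClassSize k a b oa ob
  unbalanced : a ≢ b → LeastNonzero k oa ob → MinClassSize k a b oa ob

-- For a k-MARS S of K r t with parts X, Y: a = |S ∩ X|, b = |S ∩ Y|, oa = |X ∖ S|, ob = |Y ∖ S|.
record Shape (r t k : ℕ) : Set where
  constructor shape
  field
    a b oa ob : ℕ
    a+oa≡r    : a + oa ≡ r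
    b+ob≡t    : b + ob ≡ t
    0<a+b     : 0 < a + b
    min-class : MinClassSize k a b oa ob

  size : ℕ
  size = a + b

open Shape using (size)

∃Bool⇔⊎ : ∀ {P : Bool → Set} → (∃ P) ⇔ (P true ⊎ P false)
∃Bool⇔⊎ = mk⇔ (λ { (true , p) → inj₁ p ; (false , p) → inj₂ p })
              (λ { (inj₁ p) → true , p ; (inj₂ p) → false , p })

module CompleteBipartite {r t : ℕ} (1≤r : 1 ≤ r) (1≤t : 1 ≤ t) where

  side : Fin (r + t) → Bool
  side x = toℕ x <ᵇ r

  part : Bool → Subset (r + t)
  part true  = tabulate side
  part false = ∁ (tabulate side)

  ∈-part⇔ : ∀ {x c} → x ∈ part c ⇔ side x ≡ c
  ∈-part⇔ {c = true}  = ∈-tabulate⇔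
  ∈-part⇔ {c = false} = mk⇔ (λ x∈ → ¬-not (x∈∁p⇒x∉p x∈ ∘ Equivalence.from ∈-tabulate⇔))
                            (λ side≡ → x∉p⇒x∈∁p (not-¬ side≡ ∘ Equivalence.to ∈-tabulate⇔))

  ∣part-true∣ : ∣ part true ∣ ≡ r
  ∣part-true∣ = ∣tabulate-<ᵇ∣ r (m≤m+n r t)

  ∣part-false∣ : ∣ part false ∣ ≡ t
  ∣part-false∣ = trans (∣∁p∣≡n∸∣p∣ (part true)) (trans (cong (r + t ∸_) ∣part-true∣) (m+n∸m≡n r t))

  0<∣part∣ : ∀ c → 0 < ∣ part c ∣
  0<∣part∣ true  = subst (0 <_) (sym ∣part-true∣) 1≤r
  0<∣part∣ false = subst (0 <_) (sym ∣part-false∣) 1≤t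

  vertex-on : ∀ c → ∃ λ z → side z ≡ c
  vertex-on c with z , z∈ ← 0<∣p∣⇒nonempty (0<∣part∣ c) = z , Equivalence.to ∈-part⇔ z∈

  dist-K : ∀ {x y} → x ≢ y → dist (K r t) x y ≡ sideDist (side x) (side y)
  dist-K {x} {y} x≢y = dist-diameter₂ (K r t) x≢y common-neighbour
    where
    via-other-side : ∀ c c′ → c xor c′ ≡ false → T (c xor not c) × T (not c xor c′)
    via-other-side true  true  _ = _ , _
    via-other-side false false _ = _ , _
    common-neighbour : K r t x y ≡ false → ∃ λ z → T (K r t x z) × T (K r t z y)
    common-neighbour same-side with z , side-z ← vertex-on (not (side x)) =
      z , subst (λ c → T (side x xor c) × T (c xor side y)) (sym side-z)
                (via-other-side (side x) (side y) same-side)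

  module _ (S : Subset (r + t)) where

    chosen unchosen : Bool → ℕ
    chosen   c = ∣ part c ∩ S ∣
    unchosen c = ∣ part c ∩ ∁ S ∣

    chosen+chosen≡∣S∣ : chosen true + chosen false ≡ ∣ S ∣
    chosen+chosen≡∣S∣ = ∣q∩p∣+∣∁q∩p∣≡∣p∣ (part true) S

    unchosen+unchosen≡∣∁S∣ : unchosen true + unchosen false ≡ ∣ ∁ S ∣
    unchosen+unchosen≡∣∁S∣ = ∣q∩p∣+∣∁q∩p∣≡∣p∣ (part true) (∁ S)

    chosen+unchosen≡∣part∣ : ∀ c → chosen c + unchosen c ≡ ∣ part c ∣
    chosen+unchosen≡∣part∣ c = begin
      ∣ part c ∩ S ∣ + ∣ part c ∩ ∁ S ∣  ≡⟨ cong₂ _+_ (cong ∣_∣ (∩-comm (part c) S))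
                                                       (cong ∣_∣ (∩-comm (part c) (∁ S))) ⟩
      ∣ S ∩ part c ∣ + ∣ ∁ S ∩ part c ∣  ≡⟨ ∣q∩p∣+∣∁q∩p∣≡∣p∣ S (part c) ⟩
      ∣ part c ∣                         ∎
      where open ≡-Reasoning

    distances↭profile : ∀ {x} → x ∉ S → m (K r t) x S ↭ profile (chosen true) (chosen false) (side x)
    distances↭profile {x} x∉S = begin
      map d (elems S)                                          ↭⟨ map⁺ d (elems-∩-∁-↭ (part true) S) ⟩
      map d (elems (part true ∩ S) ++ elems (part false ∩ S))  ≡⟨ map-++ d (elems (part true ∩ S)) _ ⟩
      map d (elems (part true ∩ S)) ++ map d (elems (part false ∩ S))
        ≡⟨ cong₂ _++_ (map-elems-const _ (dist-on true)) (map-elems-const _ (dist-on false)) ⟩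
      profile (chosen true) (chosen false) (side x)            ∎
      where
      open PermutationReasoning
      d = dist (K r t) x
      dist-on : ∀ c {s} → s ∈ part c ∩ S → d s ≡ sideDist (side x) c
      dist-on c s∈ with s∈part , s∈S ← x∈p∩q⁻ (part c) S s∈ =
        trans (dist-K (λ { refl → x∉S s∈S })) (cong (sideDist (side x)) (Equivalence.to ∈-part⇔ s∈part))

    Balanced : Set
    Balanced = chosen true ≡ chosen false

    ∼⇔ : ∀ {x y} → x ∉ S → y ∉ S → y ∼[ K r t , S ] x ⇔ (side y ≡ side x ⊎ Balanced)
    ∼⇔ x∉S y∉S = mk⇔
      (λ y∼x → Equivalence.to profile-↭⇔ (↭-trans (↭-sym (distances↭profile y∉S))
                                                  (↭-trans y∼x (distances↭profile x∉S))))
      (λ h → ↭-trans (distances↭profile y∉S)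
                     (↭-trans (Equivalence.from profile-↭⇔ h) (↭-sym (distances↭profile x∉S))))

    balanced-class : Balanced → ∀ {x} → x ∉ S → IsClass (K r t) S x (∁ S)
    balanced-class bal x∉S y = mk⇔
      (λ y∈∁S → let y∉S = x∈∁p⇒x∉p y∈∁S in y∉S , Equivalence.from (∼⇔ x∉S y∉S) (inj₂ bal))
      (λ (y∉S , _) → x∉p⇒x∈∁p y∉S)

    unbalanced-class : ¬ Balanced → ∀ {x} → x ∉ S → IsClass (K r t) S x (part (side x) ∩ ∁ S)
    unbalanced-class unbal {x} x∉S y = mk⇔ to from
      where
      to : y ∈ part (side x) ∩ ∁ S → y ∉ S × y ∼[ K r t , S ] x
      to y∈ with y∈part , y∈∁S ← x∈p∩q⁻ (part (side x)) (∁ S) y∈ =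
        let y∉S = x∈∁p⇒x∉p y∈∁S
        in  y∉S , Equivalence.from (∼⇔ x∉S y∉S) (inj₁ (Equivalence.to ∈-part⇔ y∈part))
      from : y ∉ S × y ∼[ K r t , S ] x → y ∈ part (side x) ∩ ∁ S
      from (y∉S , y∼x) with Equivalence.to (∼⇔ x∉S y∉S) y∼x
      ... | inj₁ same-side = x∈p∩q⁺ (Equivalence.from ∈-part⇔ same-side , x∉p⇒x∈∁p y∉S)
      ... | inj₂ bal       = ⊥-elim (unbal bal)

    0<unchosen-side : ∀ {x} → x ∉ S → 0 < unchosen (side x)
    0<unchosen-side x∉S = x∈p⇒0<∣p∣ (x∈p∩q⁺ (Equivalence.from ∈-part⇔ refl , x∉p⇒x∈∁p x∉S))

    unchosen-witness : ∀ {c} → 0 < unchosen c → ∃ λ y → y ∉ S × side y ≡ c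
    unchosen-witness 0<u with y , y∈ ← 0<∣p∣⇒nonempty 0<u with y∈part , y∈∁S ← x∈p∩q⁻ _ _ y∈ =
      y , x∈∁p⇒x∉p y∈∁S , Equivalence.to ∈-part⇔ y∈part

    IsMARS⇒MinClassSize : IsMARS (K r t) k S →
                          MinClassSize k (chosen true) (chosen false) (unchosen true) (unchosen false)
    IsMARS⇒MinClassSize {k} (_ , _ , (x , x∉S , size-k) , minimal) with chosen true ≟ chosen false
    ... | yes bal = balanced bal (subst (0 <_) (sym k≡∣∁S∣) (x∈p⇒0<∣p∣ (x∉p⇒x∈∁p x∉S)))
                                 (trans k≡∣∁S∣ (sym unchosen+unchosen≡∣∁S∣))
      where k≡∣∁S∣ = ClassSize⇒≡∣P∣ (balanced-class bal x∉S) size-k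
    ... | no unbal = unbalanced unbal ((attained , 0<k) , bound true , bound false)
      where
      k≡ : k ≡ unchosen (side x)
      k≡ = ClassSize⇒≡∣P∣ (unbalanced-class unbal x∉S) size-k
      attained = Equivalence.to (∃Bool⇔⊎ {λ c → k ≡ unchosen c}) (side x , k≡)
      0<k = subst (0 <_) (sym k≡) (0<unchosen-side x∉S)
      bound : ∀ c → 0 < unchosen c → k ≤ unchosen c
      bound c 0<u with y , y∉S , side-y ← unchosen-witness {c} 0<u =
        subst (λ c → k ≤ unchosen c) side-y
              (minimal y _ y∉S (IsClass⇒ClassSize (unbalanced-class unbal y∉S)))

    MinClassSize⇒IsMARS : 0 < ∣ S ∣ →
                          MinClassSize k (chosen true) (chosen false) (unchosen true) (unchosen false) →
                          IsMARS (K r t) k S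
    MinClassSize⇒IsMARS {k} 0<∣S∣ (balanced bal 0<k k≡)
      with x , x∈∁S ← 0<∣p∣⇒nonempty (subst (0 <_) (trans k≡ unchosen+unchosen≡∣∁S∣) 0<k) =
      0<∣p∣⇒nonempty 0<∣S∣ , (x , x∉S) , (x , x∉S , size-k) , minimal
      where
      k≡∣∁S∣ : k ≡ ∣ ∁ S ∣
      k≡∣∁S∣ = trans k≡ unchosen+unchosen≡∣∁S∣
      x∉S = x∈∁p⇒x∉p x∈∁S
      size-k : ClassSize (K r t) S x k
      size-k = subst (ClassSize (K r t) S x) (sym k≡∣∁S∣) (IsClass⇒ClassSize (balanced-class bal x∉S))
      minimal : ∀ y c → y ∉ S → ClassSize (K r t) S y c → k ≤ c
      minimal y c y∉S size-c =
        ≤-reflexive (trans k≡∣∁S∣ (sym (ClassSize⇒≡∣P∣ (balanced-class bal y∉S) size-c)))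
    MinClassSize⇒IsMARS {k} 0<∣S∣ (unbalanced unbal ((attained , 0<k) , bound-true , bound-false))
      with c , k≡ ← Equivalence.from ∃Bool⇔⊎ attained
      with x , x∉S , side-x ← unchosen-witness {c} (subst (0 <_) k≡ 0<k) =
      0<∣p∣⇒nonempty 0<∣S∣ , (x , x∉S) , (x , x∉S , size-k) , minimal
      where
      size-k : ClassSize (K r t) S x k
      size-k = subst (ClassSize (K r t) S x) (sym (trans k≡ (cong unchosen (sym side-x))))
                     (IsClass⇒ClassSize (unbalanced-class unbal x∉S))
      bound : ∀ c → 0 < unchosen c → k ≤ unchosen c
      bound true  = bound-true
      bound false = bound-false
      minimal : ∀ y c → y ∉ S → ClassSize (K r t) S y c → k ≤ c
      minimal y c y∉S size-c = subst (k ≤_) (sym (ClassSize⇒≡∣P∣ (unbalanced-class unbal y∉S) size-c))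
                                     (bound (side y) (0<unchosen-side y∉S))

  shape-of : ∀ {S} → IsMARS (K r t) k S → Σ (Shape r t k) λ σ → size σ ≡ ∣ S ∣
  shape-of {S = S} mars@((_ , x∈S) , _) =
    shape (chosen S true) (chosen S false) (unchosen S true) (unchosen S false)
          (trans (chosen+unchosen≡∣part∣ S true) ∣part-true∣)
          (trans (chosen+unchosen≡∣part∣ S false) ∣part-false∣)
          (subst (0 <_) (sym (chosen+chosen≡∣S∣ S)) (x∈p⇒0<∣p∣ x∈S))
          (IsMARS⇒MinClassSize S mars)
    , chosen+chosen≡∣S∣ S

  realise : (σ : Shape r t k) → ∃ λ S → IsMARS (K r t) k S × ∣ S ∣ ≡ size σ
  realise (shape a b oa ob a+oa≡r b+ob≡t 0<a+b min-class)
    with S , refl , refl ← ∩-∁-sizes (part true) (subst (a ≤_) (trans a+oa≡r (sym ∣part-true∣)) (m≤m+n a oa))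
                                                 (subst (b ≤_) (trans b+ob≡t (sym ∣part-false∣)) (m≤m+n b ob))
    with refl ← +-cancelˡ-≡ a _ _ (trans (chosen+unchosen≡∣part∣ S true) (trans ∣part-true∣ (sym a+oa≡r)))
    with refl ← +-cancelˡ-≡ b _ _ (trans (chosen+unchosen≡∣part∣ S false) (trans ∣part-false∣ (sym b+ob≡t)))
    = S , MinClassSize⇒IsMARS S (subst (0 <_) (chosen+chosen≡∣S∣ S) 0<a+b) min-class
        , sym (chosen+chosen≡∣S∣ S)

  msadIs : ∀ {v} → (Σ (Shape r t k) λ σ → size σ ≡ v) → (∀ σ → v ≤ size σ) → MsadIs (K r t) k v
  msadIs {v = v} (σ , size≡v) least with S , mars , ∣S∣≡size ← realise σ =
    (S , mars , trans ∣S∣≡size size≡v) ,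
    λ S′ mars′ → let σ′ , size≡∣S′∣ = shape-of mars′ in subst (v ≤_) size≡∣S′∣ (least σ′)

  noMARS : ¬ Shape r t k → NoMARS (K r t) k
  noMARS no-shape S mars = no-shape (proj₁ (shape-of mars))

-- Optimising shapes

k+size≡r+t : ∀ a b oa ob → a + oa ≡ r → b + ob ≡ t → k ≡ oa + ob → k + (a + b) ≡ r + t
k+size≡r+t a b oa ob refl refl refl = shuffle a b oa ob
  where shuffle : ∀ a b oa ob → (oa + ob) + (a + b) ≡ (a + oa) + (b + ob)
        shuffle = solve-∀

unbalanced⇒k≤r : ∀ {a b oa ob} → t ≤ r → a + oa ≡ r → b + ob ≡ t → LeastNonzero k oa ob → k ≤ r
unbalanced⇒k≤r {a = a} t≤r refl _    ((inj₁ refl , _) , _) = m≤n+m _ a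
unbalanced⇒k≤r {b = b} t≤r _    refl ((inj₂ refl , _) , _) = ≤-trans (m≤n+m _ b) t≤r

t∸k≤size : t ≤ r → (σ : Shape r t k) → t ∸ k ≤ size σ
t∸k≤size {t} {r} {k} t≤r (shape a b oa ob a+oa≡r b+ob≡t _ min-class) =
  m≤n+o⇒m∸n≤o t k (t≤k+size min-class)
  where
  open ≤-Reasoning
  t≤k+size : MinClassSize k a b oa ob → t ≤ k + (a + b)
  t≤k+size (balanced _ _ k≡) = subst (t ≤_) (sym (k+size≡r+t a b oa ob a+oa≡r b+ob≡t k≡)) (m≤n+m t r)
  t≤k+size (unbalanced _ ((inj₁ refl , _) , _)) = begin
    t             ≤⟨ t≤r ⟩
    r             ≡⟨ a+oa≡r ⟨
    a + k         ≡⟨ +-comm a k ⟩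
    k + a         ≤⟨ +-monoʳ-≤ k (m≤m+n a b) ⟩
    k + (a + b)   ∎
  t≤k+size (unbalanced _ ((inj₂ refl , _) , _)) = begin
    t             ≡⟨ b+ob≡t ⟨
    b + k         ≡⟨ +-comm b k ⟩
    k + b         ≤⟨ +-monoʳ-≤ k (m≤n+m b a) ⟩
    k + (a + b)   ∎

r+t∸k≤size : t < k → (σ : Shape r t k) → r + t ∸ k ≤ size σ
r+t∸k≤size {t} {k} {r} t<k (shape a b oa ob a+oa≡r b+ob≡t _ min-class) =
  m≤n+o⇒m∸n≤o (r + t) k (≤-reflexive (sym (k+size≡r+t a b oa ob a+oa≡r b+ob≡t (k≡oa+ob min-class))))
  where
  ob≤t : ob ≤ t
  ob≤t = subst (ob ≤_) b+ob≡t (m≤n+m ob b)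
  k≡oa+ob : MinClassSize k a b oa ob → k ≡ oa + ob
  k≡oa+ob (balanced _ _ k≡) = k≡
  k≡oa+ob (unbalanced _ ((inj₂ refl , _) , _)) = ⊥-elim (<⇒≱ t<k ob≤t)
  k≡oa+ob (unbalanced _ ((inj₁ k≡oa , _) , _ , 0<ob⇒k≤ob)) = begin
    k        ≡⟨ k≡oa ⟩
    oa       ≡⟨ +-identityʳ oa ⟨
    oa + 0   ≡⟨ cong (oa +_) ob≡0 ⟨
    oa + ob  ∎
    where
    open ≡-Reasoning
    ob≡0 : ob ≡ 0
    ob≡0 = n≤0⇒n≡0 (≮⇒≥ λ 0<ob → <⇒≱ t<k (≤-trans (0<ob⇒k≤ob 0<ob) ob≤t))

r≤size-diagonal : r ≡ t → k ≡ t → (σ : Shape r t k) → r ≤ size σ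
r≤size-diagonal {t = t} refl refl (shape a b oa ob a+oa≡t b+ob≡t _ (balanced _ _ t≡)) =
  ≤-reflexive (sym (+-cancelˡ-≡ t (a + b) t (k+size≡r+t a b oa ob a+oa≡t b+ob≡t t≡)))
r≤size-diagonal {t = t} refl refl (shape a b zero ob a+0≡t _ _ (unbalanced _ _)) =
  subst (_≤ a + b) (trans (sym (+-identityʳ a)) a+0≡t) (m≤m+n a b)
r≤size-diagonal {t = t} refl refl (shape a b (suc _) zero _ b+0≡t _ (unbalanced _ _)) =
  subst (_≤ a + b) (trans (sym (+-identityʳ b)) b+0≡t) (m≤n+m b a)
r≤size-diagonal {t = t} refl refl
  (shape a b oa@(suc _) ob@(suc _) a+oa≡t b+ob≡t _ (unbalanced a≢b (_ , t≤oa , t≤ob))) =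
  ⊥-elim (a≢b (trans (nothing-left a+oa≡t (t≤oa (s≤s z≤n))) (sym (nothing-left b+ob≡t (t≤ob (s≤s z≤n))))))
  where
  nothing-left : ∀ {c o} → c + o ≡ t → t ≤ o → c ≡ 0
  nothing-left {c} {o} c+o≡t t≤o = n≤0⇒n≡0 (+-cancelʳ-≤ o c 0 (subst (_≤ o) (sym c+o≡t) t≤o))

shape-k<t : 1 < k → k < t → t ≤ r → Σ (Shape r t k) λ σ → size σ ≡ t ∸ k
shape-k<t {k} {t} {r} 1<k k<t t≤r =
  shape 0 (t ∸ k) r k refl (m∸n+n≡m (<⇒≤ k<t)) (m<n⇒0<n∸m k<t)
        (unbalanced (<⇒≢ (m<n⇒0<n∸m k<t))
                    ((inj₂ refl , <⇒≤ 1<k) , (λ _ → ≤-trans (<⇒≤ k<t) t≤r) , (λ _ → ≤-refl)))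
  , refl

shape-k≡t<r : 1 ≤ t → k ≡ t → t < r → Σ (Shape r t k) λ σ → size σ ≡ 1
shape-k≡t<r {t} {r = r} 1≤t refl t<r =
  shape 1 0 (r ∸ 1) t (m+[n∸m]≡n (≤-trans 1≤t (<⇒≤ t<r))) refl (s≤s z≤n)
        (unbalanced (λ ()) ((inj₂ refl , 1≤t) , (λ _ → ∸-monoˡ-≤ 1 t<r) , (λ _ → ≤-refl)))
  , refl

shape-k≡t≡r : 1 ≤ t → k ≡ t → r ≡ t → Σ (Shape r t k) λ σ → size σ ≡ r
shape-k≡t≡r {t} 1≤t refl refl =
  shape t 0 0 t (+-identityʳ t) refl (subst (0 <_) (sym (+-identityʳ t)) 1≤t)
        (unbalanced (≢-sym (<⇒≢ 1≤t)) ((inj₂ refl , 1≤t) , (λ ()) , (λ _ → ≤-refl)))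
  , +-identityʳ t

shape-t<k≤r : 1 ≤ t → t < k → k ≤ r → Σ (Shape r t k) λ σ → size σ ≡ r + t ∸ k
shape-t<k≤r {t} {k} {r} 1≤t t<k k≤r =
  shape (r ∸ k) t k 0 (m∸n+n≡m k≤r) (+-identityʳ t) (≤-trans 1≤t (m≤n+m t (r ∸ k))) min-class
  , sym (+-∸-comm t k≤r)
  where
  0<k : 0 < k
  0<k = ≤-trans (s≤s z≤n) t<k
  min-class : MinClassSize k (r ∸ k) t k 0
  min-class with r ∸ k ≟ t
  ... | yes bal  = balanced bal 0<k (sym (+-identityʳ k))
  ... | no unbal = unbalanced unbal ((inj₁ refl , 0<k) , (λ _ → ≤-refl) , (λ ()))

SameParity OppositeParity : ℕ → ℕ → Set
SameParity     m n = (Even m × Even n) ⊎ (Odd m × Odd n)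
OppositeParity m n = (Even m × Odd n) ⊎ (Odd m × Even n)

private
  j+j≡j*2 : ∀ j → j + j ≡ j * 2
  j+j≡j*2 = solve-∀

Even-double : ∀ j → Even (j + j)
Even-double j = divides j (j+j≡j*2 j)

Even⊎Even-suc : ∀ n → Even n ⊎ Even (suc n)
Even⊎Even-suc zero    = inj₁ (divides 0 refl)
Even⊎Even-suc (suc n) with Even⊎Even-suc n
... | inj₁ even-n   = inj₂ (∣m∣n⇒∣m+n (∣-refl {2}) even-n)
... | inj₂ even-1+n = inj₁ even-1+n

Odd⇒Even-suc : Odd n → Even (suc n)
Odd⇒Even-suc {n} odd-n with Even⊎Even-suc n
... | inj₁ even-n   = ⊥-elim (odd-n even-n)
... | inj₂ even-1+n = even-1+n

SameParity⇒Even-∸ : k ≤ n → SameParity k n → Even (n ∸ k)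
SameParity⇒Even-∸ k≤n (inj₁ (even-k , even-n)) =
  ∣m+n∣m⇒∣n (subst Even (sym (m+[n∸m]≡n k≤n)) even-n) even-k
SameParity⇒Even-∸ k≤n (inj₂ (odd-k , odd-n)) =
  ∣m+n∣m⇒∣n (subst Even (sym (cong suc (m+[n∸m]≡n k≤n))) (Odd⇒Even-suc odd-n)) (Odd⇒Even-suc odd-k)

half-difference : k ≤ n → SameParity k n → ∃ λ j → k + (j + j) ≡ n
half-difference {k} {n} k≤n same with divides j n∸k≡j*2 ← SameParity⇒Even-∸ k≤n same = j , (begin
  k + (j + j)   ≡⟨ cong (k +_) (trans (j+j≡j*2 j) (sym n∸k≡j*2)) ⟩
  k + (n ∸ k)   ≡⟨ m+[n∸m]≡n k≤n ⟩
  n             ∎)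
  where open ≡-Reasoning

OppositeParity-double : ∀ {j} → k + (j + j) ≡ n → ¬ OppositeParity k n
OppositeParity-double {j = j} k+2j≡n (inj₁ (even-k , odd-n)) =
  odd-n (subst Even k+2j≡n (∣m∣n⇒∣m+n even-k (Even-double j)))
OppositeParity-double {k} {j = j} k+2j≡n (inj₂ (odd-k , even-n)) =
  odd-k (∣m+n∣m⇒∣n (subst Even (trans (sym k+2j≡n) (+-comm k (j + j))) even-n) (Even-double j))

shape-r<k : 1 ≤ t → t ≤ r → r < k → k ≤ r + t ∸ 2 → SameParity k (r + t) →
            Σ (Shape r t k) λ σ → size σ ≡ r + t ∸ k
shape-r<k {t} {r} {k} 1≤t t≤r r<k k≤r+t∸2 same
  with j , k+2j≡r+t ← half-difference (≤-trans k≤r+t∸2 (m∸n≤m (r + t) 2)) same =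
  shape j j (r ∸ j) (t ∸ j) (m+[n∸m]≡n j≤r) (m+[n∸m]≡n j≤t) 0<j+j (balanced refl 0<k k≡oa+ob)
  , sym (trans (cong (_∸ k) (sym k+2j≡r+t)) (m+n∸m≡n k (j + j)))
  where
  0<k : 0 < k
  0<k = ≤-trans (s≤s z≤n) (≤-trans 1≤t (≤-trans t≤r (<⇒≤ r<k)))
  2j<t : j + j < t
  2j<t = +-cancelˡ-< r (j + j) t (begin-strict
    r + (j + j)   <⟨ +-monoˡ-< (j + j) r<k ⟩
    k + (j + j)   ≡⟨ k+2j≡r+t ⟩
    r + t         ∎)
    where open ≤-Reasoning
  j≤t : j ≤ t
  j≤t = ≤-trans (m≤m+n j j) (<⇒≤ 2j<t)
  j≤r : j ≤ r
  j≤r = ≤-trans j≤t t≤r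
  0<j+j : 0 < j + j
  0<j+j = +-cancelˡ-≤ k 1 (j + j) (begin
    k + 1         ≤⟨ +-monoʳ-≤ k (s≤s z≤n) ⟩
    k + 2         ≤⟨ m≤o∸n⇒m+n≤o k (+-mono-≤ (≤-trans 1≤t t≤r) 1≤t) k≤r+t∸2 ⟩
    r + t         ≡⟨ k+2j≡r+t ⟨
    k + (j + j)   ∎)
    where open ≤-Reasoning
  k≡oa+ob : k ≡ (r ∸ j) + (t ∸ j)
  k≡oa+ob = +-cancelʳ-≡ (j + j) k _
    (trans k+2j≡r+t (sym (k+size≡r+t j j (r ∸ j) (t ∸ j) (m+[n∸m]≡n j≤r) (m+[n∸m]≡n j≤t) refl)))

no-shape-r<k : t ≤ r → r < k → OppositeParity k (r + t) → ¬ Shape r t k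
no-shape-r<k t≤r r<k opposite (shape a b oa ob a+oa≡r b+ob≡t _ (balanced refl _ k≡)) =
  OppositeParity-double {j = a} (k+size≡r+t a a oa ob a+oa≡r b+ob≡t k≡) opposite
no-shape-r<k t≤r r<k _ (shape a b oa ob a+oa≡r b+ob≡t _ (unbalanced _ least)) =
  <⇒≱ r<k (unbalanced⇒k≤r t≤r a+oa≡r b+ob≡t least)

proposition8 : (r t k : ℕ) → 1 ≤ t → t ≤ r →
    ((1 < k → k < t → MsadIs (K r t) k (t ∸ k)) ×
     (k ≡ t → (r > t → MsadIs (K r t) k 1) × (r ≡ t → MsadIs (K r t) k r)) ×
     (t < k → k ≤ r → MsadIs (K r t) k (r + t ∸ k)) ×
     (r < k → k ≤ r + t ∸ 2 → ((Even k × Even (r + t)) ⊎ (Odd k × Odd (r + t))) →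
        MsadIs (K r t) k (r + t ∸ k)) ×
     (r < k → k ≤ r + t ∸ 2 → ((Even k × Odd (r + t)) ⊎ (Odd k × Even (r + t))) →
        NoMARS (K r t) k))
proposition8 r t k 1≤t t≤r =
    (λ 1<k k<t → msadIs (shape-k<t 1<k k<t t≤r) (t∸k≤size t≤r))
  , (λ k≡t → (λ t<r → msadIs (shape-k≡t<r 1≤t k≡t t<r) Shape.0<a+b)
           , (λ r≡t → msadIs (shape-k≡t≡r 1≤t k≡t r≡t) (r≤size-diagonal r≡t k≡t)))
  , (λ t<k k≤r → msadIs (shape-t<k≤r 1≤t t<k k≤r) (r+t∸k≤size t<k))
  , (λ r<k k≤r+t∸2 same → msadIs (shape-r<k 1≤t t≤r r<k k≤r+t∸2 same) (r+t∸k≤size (≤-<-trans t≤r r<k)))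
  , (λ r<k _ opposite → noMARS (no-shape-r<k t≤r r<k opposite))
  where open CompleteBipartite (≤-trans 1≤t t≤r) 1≤t
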